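{- Let $(R,\oplus,\cdot,0,1)$ be a ring-like structure of events (RLSE) and let $\le$ be the partial order induced by the meet-semilattice $(R,\cdot)$ (i.e. $x\le y$ iff $xy=x$). Then for all $x,y\in R$: (a) $(x\oplus1)\oplus1=x$; (b) $x(x\oplus1)=0$, and consequently $1\oplus1=0$; (c) $x\oplus0=x$; (d) $x\oplus(x\oplus1)=1$; (e) $x\le y$ if and only if $y\oplus1\le x\oplus1$.
   Context: A ring-like structure of events (RLSE) is an algebra $(R,\oplus,\cdot,0,1)$ of type $(2,2,0,0)$ such that $(R,\cdot,1)$ is an idempotent commutative monoid with zero element $0$ (i.e. $x0=0$ for all $x$), satisfying the identities (R1) $x\oplus y= y\oplus x$; (R2) $(xy\oplus1)(x\oplus1)\oplus1= x$; (R3) $((xy\oplus1)x\oplus1)x= xy$; (R4) $xy\oplus(x\oplus1)=(xy\oplus1)x\oplus1$. -}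

module Defs where

open import Level using (Level; suc)
open import Relation.Binary.PropositionalEquality using (_≡_)

record RLSE (c : Level) : Set (suc c) where
  infixl 6 _⊕_
  infixl 7 _·_
  field
    Carrier : Set c
    _⊕_     : Carrier → Carrier → Carrier
    _·_     : Carrier → Carrier → Carrier
    𝟘       : Carrier
    𝟙       : Carrier
    ·-assoc  : ∀ x y z → (x · y) · z ≡ x · (y · z)
    ·-comm   : ∀ x y → x · y ≡ y · x
    ·-identityˡ : ∀ x → 𝟙 · x ≡ x
    ·-idem   : ∀ x → x · x ≡ x
    ·-zeroʳ  : ∀ x → x · 𝟘 ≡ 𝟘
    R1 : ∀ x y → x ⊕ y ≡ y ⊕ x
    R2 : ∀ x y → ((x · y ⊕ 𝟙) · (x ⊕ 𝟙)) ⊕ 𝟙 ≡ x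
    R3 : ∀ x y → (((x · y ⊕ 𝟙) · x) ⊕ 𝟙) · x ≡ x · y
    R4 : ∀ x y → x · y ⊕ (x ⊕ 𝟙) ≡ ((x · y ⊕ 𝟙) · x) ⊕ 𝟙

  infix 4 _≤_
  _≤_ : Carrier → Carrier → Set c
  x ≤ y = x · y ≡ x

{-# OPTIONS --safe #-}
module Submission where

open import Defs
open import Level using (Level)
open import Data.Product using (_×_; _,_)
open import Function.Bundles using (_⇔_; mk⇔)
open import Relation.Binary.PropositionalEquality
  using (_≡_; sym; trans; cong; subst; subst₂; module ≡-Reasoning)

-- Write xᶜ for x ⊕ 1.  Instantiating y := 1 in (R2) gives involutivity of ᶜ, and
-- (R2) in general says xᶜ ≤ (xy)ᶜ, so ᶜ is antitone.  Since x·0 = 0, every xᶜ lies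
-- below 0ᶜ, whence 0ᶜ = 1.  With this, (R3) and (R4) at y := 0 give x·xᶜ = 0 and
-- 0 ⊕ xᶜ = xᶜ, and (R4) at y := 1 gives x ⊕ xᶜ = (xᶜ·x)ᶜ = 0ᶜ = 1.

module RLSE-Properties {c : Level} (R : RLSE c) where
  open RLSE R
  open ≡-Reasoning

  infix 8 _ᶜ
  _ᶜ : Carrier → Carrier
  x ᶜ = x ⊕ 𝟙

  ·-identityʳ : ∀ x → x · 𝟙 ≡ x
  ·-identityʳ x = trans (·-comm x 𝟙) (·-identityˡ x)

  ᶜ-involutive : ∀ x → x ᶜ ᶜ ≡ x
  ᶜ-involutive x = begin
    x ᶜ ᶜ                      ≡⟨ cong _ᶜ (sym (·-idem (x ᶜ))) ⟩
    (x ᶜ · x ᶜ) ᶜ              ≡⟨ cong (λ t → (t ᶜ · x ᶜ) ᶜ) (sym (·-identityʳ x)) ⟩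
    ((x · 𝟙) ᶜ · x ᶜ) ᶜ        ≡⟨ R2 x 𝟙 ⟩
    x                          ∎

  ᶜ-injective : ∀ {x y} → x ᶜ ≡ y ᶜ → x ≡ y
  ᶜ-injective {x} {y} e = begin
    x       ≡⟨ sym (ᶜ-involutive x) ⟩
    x ᶜ ᶜ   ≡⟨ cong _ᶜ e ⟩
    y ᶜ ᶜ   ≡⟨ ᶜ-involutive y ⟩
    y       ∎

  ᶜ-≤-·ᶜ : ∀ x y → x ᶜ ≤ (x · y) ᶜ
  ᶜ-≤-·ᶜ x y = ᶜ-injective (begin
    (x ᶜ · (x · y) ᶜ) ᶜ   ≡⟨ cong _ᶜ (·-comm (x ᶜ) ((x · y) ᶜ)) ⟩
    ((x · y) ᶜ · x ᶜ) ᶜ   ≡⟨ R2 x y ⟩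
    x                     ≡⟨ sym (ᶜ-involutive x) ⟩
    x ᶜ ᶜ                 ∎)

  ᶜ-antitone : ∀ {x y} → x ≤ y → y ᶜ ≤ x ᶜ
  ᶜ-antitone {x} {y} x≤y =
    subst (λ t → y ᶜ ≤ t ᶜ) (trans (·-comm y x) x≤y) (ᶜ-≤-·ᶜ y x)

  ᶜ-reflects-≤ : ∀ {x y} → y ᶜ ≤ x ᶜ → x ≤ y
  ᶜ-reflects-≤ {x} {y} yᶜ≤xᶜ =
    subst₂ _≤_ (ᶜ-involutive x) (ᶜ-involutive y) (ᶜ-antitone yᶜ≤xᶜ)

  ᶜ-≤-𝟘ᶜ : ∀ x → x ᶜ ≤ 𝟘 ᶜ
  ᶜ-≤-𝟘ᶜ x = subst (λ t → x ᶜ ≤ t ᶜ) (·-zeroʳ x) (ᶜ-≤-·ᶜ x 𝟘)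

  𝟘ᶜ≡𝟙 : 𝟘 ᶜ ≡ 𝟙
  𝟘ᶜ≡𝟙 = begin
    𝟘 ᶜ        ≡⟨ sym (·-identityˡ (𝟘 ᶜ)) ⟩
    𝟙 · 𝟘 ᶜ    ≡⟨ subst (λ t → t · 𝟘 ᶜ ≡ t) (ᶜ-involutive 𝟙) (ᶜ-≤-𝟘ᶜ (𝟙 ᶜ)) ⟩
    𝟙          ∎

  ·-complementʳ : ∀ x → x · x ᶜ ≡ 𝟘
  ·-complementʳ x = begin
    x · x ᶜ                     ≡⟨ ·-comm x (x ᶜ) ⟩
    x ᶜ · x                     ≡⟨ cong (λ t → t ᶜ · x) (sym (·-identityˡ x)) ⟩
    (𝟙 · x) ᶜ · x               ≡⟨ cong (λ t → (t · x) ᶜ · x) (sym 𝟘ᶜ≡𝟙) ⟩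
    (𝟘 ᶜ · x) ᶜ · x             ≡⟨ cong (λ t → (t ᶜ · x) ᶜ · x) (sym (·-zeroʳ x)) ⟩
    ((x · 𝟘) ᶜ · x) ᶜ · x       ≡⟨ R3 x 𝟘 ⟩
    x · 𝟘                       ≡⟨ ·-zeroʳ x ⟩
    𝟘                           ∎

  𝟙ᶜ≡𝟘 : 𝟙 ᶜ ≡ 𝟘
  𝟙ᶜ≡𝟘 = trans (sym (·-identityˡ (𝟙 ᶜ))) (·-complementʳ 𝟙)

  ⊕-identityˡ-ᶜ : ∀ x → 𝟘 ⊕ x ᶜ ≡ x ᶜ
  ⊕-identityˡ-ᶜ x = begin
    𝟘 ⊕ x ᶜ                 ≡⟨ cong (_⊕ x ᶜ) (sym (·-zeroʳ x)) ⟩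
    x · 𝟘 ⊕ x ᶜ             ≡⟨ R4 x 𝟘 ⟩
    ((x · 𝟘) ᶜ · x) ᶜ       ≡⟨ cong (λ t → (t ᶜ · x) ᶜ) (·-zeroʳ x) ⟩
    (𝟘 ᶜ · x) ᶜ             ≡⟨ cong (λ t → (t · x) ᶜ) 𝟘ᶜ≡𝟙 ⟩
    (𝟙 · x) ᶜ               ≡⟨ cong _ᶜ (·-identityˡ x) ⟩
    x ᶜ                     ∎

  ⊕-identityʳ : ∀ x → x ⊕ 𝟘 ≡ x
  ⊕-identityʳ x = begin
    x ⊕ 𝟘        ≡⟨ R1 x 𝟘 ⟩
    𝟘 ⊕ x        ≡⟨ cong (𝟘 ⊕_) (sym (ᶜ-involutive x)) ⟩
    𝟘 ⊕ x ᶜ ᶜ    ≡⟨ ⊕-identityˡ-ᶜ (x ᶜ) ⟩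
    x ᶜ ᶜ        ≡⟨ ᶜ-involutive x ⟩
    x            ∎

  ⊕-complementʳ : ∀ x → x ⊕ x ᶜ ≡ 𝟙
  ⊕-complementʳ x = begin
    x ⊕ x ᶜ                 ≡⟨ cong (_⊕ x ᶜ) (sym (·-identityʳ x)) ⟩
    x · 𝟙 ⊕ x ᶜ             ≡⟨ R4 x 𝟙 ⟩
    ((x · 𝟙) ᶜ · x) ᶜ       ≡⟨ cong (λ t → (t ᶜ · x) ᶜ) (·-identityʳ x) ⟩
    (x ᶜ · x) ᶜ             ≡⟨ cong _ᶜ (trans (·-comm (x ᶜ) x) (·-complementʳ x)) ⟩
    𝟘 ᶜ                     ≡⟨ 𝟘ᶜ≡𝟙 ⟩
    𝟙                       ∎

corollary2p2 : ∀ {c : Level} (R : RLSE c) → let open RLSE R in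
    (∀ x → (x ⊕ 𝟙) ⊕ 𝟙 ≡ x)
    × (∀ x → x · (x ⊕ 𝟙) ≡ 𝟘)
    × (𝟙 ⊕ 𝟙 ≡ 𝟘)
    × (∀ x → x ⊕ 𝟘 ≡ x)
    × (∀ x → x ⊕ (x ⊕ 𝟙) ≡ 𝟙)
    × (∀ x y → (x ≤ y) ⇔ ((y ⊕ 𝟙) ≤ (x ⊕ 𝟙)))
corollary2p2 R =
    ᶜ-involutive
  , ·-complementʳ
  , 𝟙ᶜ≡𝟘
  , ⊕-identityʳ
  , ⊕-complementʳ
  , λ x y → mk⇔ ᶜ-antitone ᶜ-reflects-≤
  where open RLSE-Properties R
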